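{- For every integer $d \ge 1$ and every integer $k \ge 1$ there exists a matrix $A: X \times Y \rightarrow \{0,1,\ldots,k\}$ such that $\mathrm{Vdim}(A) = \mathrm{Vdim}(\dot A) = d$ and $\mathrm{Pdim}(A) = k \cdot d$.
   Context: A matrix is a function $A: X \times Y \rightarrow Z$ with $Z \subseteq \mathbb{R}$ (rows indexed by $X$, columns by $Y$). A set $J \subseteq Y$ is P-shattered by $A$ if there is $\vec t: J \rightarrow \mathbb{R}$ such that for every $b: J \rightarrow \{0,1\}$ there is $x \in X$ with, for all $y \in J$, $A(x,y) \ge \vec t(y)$ iff $b(y)=1$; $J$ is V-shattered if the same holds with a single number $t \in \mathbb{R}$ in place of all $\vec t(y)$. $\mathrm{Pdim}(A)$ (resp. $\mathrm{Vdim}(A)$) is the largest size of a P-shattered (resp. V-shattered) subset of $Y$ ($\infty$ if unbounded). For a matrix $A: X \times Y \rightarrow Z$, $\dot A: (X \cup \{0\}) \times Y \rightarrow Z$ (with $0 \notin X$) denotes $A$ augmented by an extra row indexed $0$ with $\dot A(0,y) = 0$ for all $y \in Y$.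
   Formalization: The thresholds $t$ and $\vec t(y)$ in V- and P-shattering are taken in the rationals rather than the reals. -}

module Defs where

open import Data.Nat using (ℕ; suc; _≤_)
open import Data.Fin using (Fin; toℕ)
open import Data.Bool using (Bool; true)
open import Data.Maybe using (Maybe; just; nothing)
open import Data.Product using (Σ; _×_; _,_)
open import Data.Integer using (+_)
open import Data.Rational using (ℚ; _/_) renaming (_≥_ to _≥ℚ_)
open import Function.Definitions using (Injective)
open import Relation.Binary.PropositionalEquality using (_≡_)
open import Function.Bundles using (_⇔_)

-- natural numbers viewed as rationals (the matrix entries, Z ⊆ ℝ)
ℕtoℚ : ℕ → ℚ
ℕtoℚ n = (+ n) / 1

Matrix : Set → Set → ℕ → Set
Matrix X Y k = X → Y → Fin (suc k)

entry : {X Y : Set} {k : ℕ} → Matrix X Y k → X → Y → ℚ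
entry A x y = ℕtoℚ (toℕ (A x y))

Subset : Set → ℕ → Set
Subset Y n = Σ (Fin n → Y) λ J → Injective _≡_ _≡_ J

PShattered : {X Y : Set} {k n : ℕ} → Matrix X Y k → Subset Y n → Set
PShattered {X} {Y} {k} {n} A (J , _) =
  Σ (Fin n → ℚ) λ t → (b : Fin n → Bool) →
    Σ X λ x → (i : Fin n) → (entry A x (J i) ≥ℚ t i) ⇔ (b i ≡ true)

VShattered : {X Y : Set} {k n : ℕ} → Matrix X Y k → Subset Y n → Set
VShattered {X} {Y} {k} {n} A (J , _) =
  Σ ℚ λ t → (b : Fin n → Bool) →
    Σ X λ x → (i : Fin n) → (entry A x (J i) ≥ℚ t) ⇔ (b i ≡ true)

LargestShatteredSize : (Y : Set) → ((n : ℕ) → Subset Y n → Set) → ℕ → Set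
LargestShatteredSize Y S d =
  (Σ (Subset Y d) λ J → S d J) × ((n : ℕ) (J : Subset Y n) → S n J → n ≤ d)

Pdim≡ : {X Y : Set} {k : ℕ} → Matrix X Y k → ℕ → Set
Pdim≡ {Y = Y} A d = LargestShatteredSize Y (λ n J → PShattered A J) d

Vdim≡ : {X Y : Set} {k : ℕ} → Matrix X Y k → ℕ → Set
Vdim≡ {Y = Y} A d = LargestShatteredSize Y (λ n J → VShattered A J) d

dot : {X Y : Set} {k : ℕ} → Matrix X Y k → Matrix (Maybe X) Y k
dot A (just x) y = A x y
dot A nothing  y = Data.Fin.zero

{-# OPTIONS --safe #-}
-- Take columns Fin k × Fin d and, for every bit pattern x on the columns, the row
-- (j , i) ↦ j + x (j , i).  With the per-column thresholds j + 1 all k·d columns are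
-- P-shattered.  Within a block {(j , i) | j < k} of fixed i every row (the zero row
-- included) is nondecreasing in j, so a single threshold never separates two columns
-- of one block: a V-shattered set meets each of the d blocks at most once, and the
-- columns (0 , i) attain this bound.
module Submission where

open import Defs
open import Data.Nat using (ℕ; _≥_; _*_; suc; _≤_; _+_; z≤n)
import Data.Nat.Properties as ℕ
open import Data.Fin using (Fin; toℕ; zero; inject₁; combine; remQuot; _≟_) renaming (suc to fsuc)
import Data.Fin.Properties as Fin
open import Data.Bool using (Bool; true; false; if_then_else_)
open import Data.Maybe using (just; nothing)
open import Data.Product using (Σ; _×_; _,_; proj₁; proj₂; uncurry)
open import Data.Sum as Sum using (_⊎_; inj₁; inj₂)
open import Data.Integer using (+_; +≤+) renaming (_≤_ to _≤ℤ_)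
import Data.Integer.Properties as ℤ
open import Data.Rational using (mkℚ; *≤*) renaming (_≤_ to _≤ℚ_; _≥_ to _≥ℚ_)
import Data.Rational.Properties as ℚ
import Data.Nat.Coprimality as Coprime
open import Data.Empty using (⊥-elim)
open import Relation.Nullary using (¬_; does; yes; no)
open import Relation.Nullary.Decidable using (dec-true; dec-false)
open import Relation.Binary.PropositionalEquality
open import Function using (_∘_)
open import Function.Bundles using (_⇔_; mk⇔; module Equivalence)
open import Function.Definitions using (Injective)

ℕtoℚ≡mkℚ : ∀ n → ℕtoℚ n ≡ mkℚ (+ n) 0 (Coprime.sym (Coprime.1-coprimeTo n))
ℕtoℚ≡mkℚ n = ℚ.normalize-coprime (Coprime.sym (Coprime.1-coprimeTo n))

ℕtoℚ-mono-≤ : ∀ {m n} → m ≤ n → ℕtoℚ m ≤ℚ ℕtoℚ n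
ℕtoℚ-mono-≤ {m} {n} m≤n = subst₂ _≤ℚ_ (sym (ℕtoℚ≡mkℚ m)) (sym (ℕtoℚ≡mkℚ n))
  (*≤* (subst₂ _≤ℤ_ (sym (ℤ.*-identityʳ (+ m))) (sym (ℤ.*-identityʳ (+ n))) (+≤+ m≤n)))

ℕtoℚ-cancel-≤ : ∀ {m n} → ℕtoℚ m ≤ℚ ℕtoℚ n → m ≤ n
ℕtoℚ-cancel-≤ {m} {n} p with subst₂ _≤ℚ_ (ℕtoℚ≡mkℚ m) (ℕtoℚ≡mkℚ n) p
... | *≤* q = ℤ.drop‿+≤+ (subst₂ _≤ℤ_ (ℤ.*-identityʳ (+ m)) (ℤ.*-identityʳ (+ n)) q)

bit : Bool → ℕ
bit false = 0
bit true  = 1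

offset-≥-threshold : ∀ {v m c} → v ≡ m + bit c → (ℕtoℚ v ≥ℚ ℕtoℚ (suc m)) ⇔ (c ≡ true)
offset-≥-threshold {m = m} {c} refl = mk⇔ (to c) from
  where
  to : ∀ c → ℕtoℚ (m + bit c) ≥ℚ ℕtoℚ (suc m) → c ≡ true
  to true  _ = refl
  to false p = ⊥-elim (ℕ.1+n≰n (subst (suc m ≤_) (ℕ.+-identityʳ m) (ℕtoℚ-cancel-≤ p)))
  from : c ≡ true → ℕtoℚ (m + bit c) ≥ℚ ℕtoℚ (suc m)
  from refl = ℕtoℚ-mono-≤ (ℕ.≤-reflexive (ℕ.+-comm 1 m))

subsetWithRetraction : ∀ {Y : Set} {n} (J : Fin n → Y) (g : Y → Fin n) →
                       (∀ i → g (J i) ≡ i) → Subset Y n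
subsetWithRetraction J g gJ≡id =
  J , λ {a} {b} eq → trans (sym (gJ≡id a)) (trans (cong g eq) (gJ≡id b))

Subset-size≤ : ∀ {Y : Set} {m n} (f : Y → Fin m) → Injective _≡_ _≡_ f → Subset Y n → n ≤ m
Subset-size≤ f f-inj (J , J-inj) = Fin.injective⇒≤ (J-inj ∘ f-inj)

uncurry-combine-injective : ∀ {m n} → Injective _≡_ _≡_ (uncurry (combine {m} {n}))
uncurry-combine-injective {x = j , i} {j' , i'} eq =
  uncurry (cong₂ _,_) (Fin.combine-injective j i j' i' eq)

module _ {X Y : Set} {k : ℕ} (A : Matrix X Y k) where

  RealisesOffsets : ∀ {n} → (Fin n → Y) → (Fin n → ℕ) → Set
  RealisesOffsets {n} J base =
    (b : Fin n → Bool) → Σ X λ x → ∀ i → toℕ (A x (J i)) ≡ base i + bit (b i)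

  PShattered-byOffsets : ∀ {n} (J : Subset Y n) (base : Fin n → ℕ) →
                         RealisesOffsets (proj₁ J) base → PShattered A J
  PShattered-byOffsets J base realise = (λ i → ℕtoℚ (suc (base i))) , λ b →
    proj₁ (realise b) , λ i → offset-≥-threshold (proj₂ (realise b) i)

  VShattered-byOffsets : ∀ {n} (J : Subset Y n) (m : ℕ) →
                         RealisesOffsets (proj₁ J) (λ _ → m) → VShattered A J
  VShattered-byOffsets J m realise = ℕtoℚ (suc m) , λ b →
    proj₁ (realise b) , λ i → offset-≥-threshold (proj₂ (realise b) i)

  Dominated : Y → Y → Set
  Dominated y y' = ∀ x → toℕ (A x y) ≤ toℕ (A x y')

  VShattered⇒¬Dominated : ∀ {n} (J : Subset Y n) → VShattered A J →
                          ∀ {a a'} → a' ≢ a → ¬ Dominated (proj₁ J a) (proj₁ J a')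
  VShattered⇒¬Dominated {n} (J , _) (t , shatter) {a} {a'} a'≢a dominated =
    a'-unselected (to (realised a') (ℚ.≤-trans (from (realised a) (dec-true (a ≟ a) refl))
                                              (ℕtoℚ-mono-≤ (dominated x))))
    where
    open Equivalence
    selectOnly-a : Fin n → Bool
    selectOnly-a m = does (m ≟ a)
    x : X
    x = proj₁ (shatter selectOnly-a)
    realised : ∀ i → (entry A x (J i) ≥ℚ t) ⇔ (selectOnly-a i ≡ true)
    realised = proj₂ (shatter selectOnly-a)
    a'-unselected : selectOnly-a a' ≢ true
    a'-unselected rewrite dec-false (a' ≟ a) a'≢a = λ ()

  VShattered-size≤ : ∀ {d n} (block : Y → Fin d) →
                     (∀ {y y'} → block y ≡ block y' → Dominated y y' ⊎ Dominated y' y) →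
                     (J : Subset Y n) → VShattered A J → n ≤ d
  VShattered-size≤ block comparable J@(J-enum , _) shattered = Fin.injective⇒≤ block∘J-inj
    where
    block∘J-inj : Injective _≡_ _≡_ (block ∘ J-enum)
    block∘J-inj {a} {a'} eq with a ≟ a'
    ... | yes a≡a' = a≡a'
    ... | no a≢a' with comparable eq
    ...   | inj₁ dominated = ⊥-elim (VShattered⇒¬Dominated J shattered (a≢a' ∘ sym) dominated)
    ...   | inj₂ dominated = ⊥-elim (VShattered⇒¬Dominated J shattered a≢a' dominated)

module _ {X Y : Set} {k : ℕ} (A : Matrix X Y k) where

  VShattered-dot : ∀ {n} (J : Subset Y n) → VShattered A J → VShattered (dot A) J
  VShattered-dot J (t , shatter) = t , λ b → just (proj₁ (shatter b)) , proj₂ (shatter b)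

  Dominated-dot : ∀ {y y'} → Dominated A y y' → Dominated (dot A) y y'
  Dominated-dot dominated (just x) = dominated x
  Dominated-dot dominated nothing  = z≤n

module Staircase (k d : ℕ) where

  Column : Set
  Column = Fin k × Fin d

  Row : Set
  Row = Column → Bool

  staircase : Matrix Row Column k
  staircase x (j , i) = if x (j , i) then fsuc j else inject₁ j

  toℕ-staircase : ∀ x y → toℕ (staircase x y) ≡ toℕ (proj₁ y) + bit (x y)
  toℕ-staircase x y with x y
  ... | true  = ℕ.+-comm 1 (toℕ (proj₁ y))
  ... | false = trans (Fin.toℕ-inject₁ (proj₁ y)) (sym (ℕ.+-identityʳ _))

  staircase-realises : ∀ {n} (J : Fin n → Column) (g : Column → Fin n) →
                       (∀ i → g (J i) ≡ i) →
                       RealisesOffsets staircase J (toℕ ∘ proj₁ ∘ J)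
  staircase-realises J g gJ≡id b = b ∘ g , λ i →
    trans (toℕ-staircase (b ∘ g) (J i)) (cong (λ m → toℕ (proj₁ (J i)) + bit (b m)) (gJ≡id i))

  staircase-mono : ∀ x {j j'} i → toℕ j ≤ toℕ j' →
                   toℕ (staircase x (j , i)) ≤ toℕ (staircase x (j' , i))
  staircase-mono x {j} {j'} i j≤j' with ℕ.m≤n⇒m<n∨m≡n j≤j'
  ... | inj₂ j≡j' rewrite Fin.toℕ-injective j≡j' = ℕ.≤-refl
  ... | inj₁ j<j' = begin
    toℕ (staircase x (j , i))     ≡⟨ toℕ-staircase x (j , i) ⟩
    toℕ j + bit (x (j , i))       ≤⟨ ℕ.+-monoʳ-≤ (toℕ j) (bit≤1 (x (j , i))) ⟩
    toℕ j + 1                     ≡⟨ ℕ.+-comm (toℕ j) 1 ⟩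
    suc (toℕ j)                   ≤⟨ j<j' ⟩
    toℕ j'                        ≤⟨ ℕ.m≤m+n (toℕ j') _ ⟩
    toℕ j' + bit (x (j' , i))     ≡⟨ toℕ-staircase x (j' , i) ⟨
    toℕ (staircase x (j' , i))    ∎
    where
    open ℕ.≤-Reasoning
    bit≤1 : ∀ c → bit c ≤ 1
    bit≤1 true  = ℕ.≤-refl
    bit≤1 false = z≤n

  blocks-comparable : ∀ {y y' : Column} → proj₂ y ≡ proj₂ y' →
                      Dominated staircase y y' ⊎ Dominated staircase y' y
  blocks-comparable {j , i} {j' , .i} refl with ℕ.≤-total (toℕ j) (toℕ j')
  ... | inj₁ j≤j' = inj₁ λ x → staircase-mono x i j≤j'
  ... | inj₂ j'≤j = inj₂ λ x → staircase-mono x i j'≤j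

  level : Fin k → Subset Column d
  level j = subsetWithRetraction (j ,_) proj₂ (λ _ → refl)

  VShattered-level : ∀ j → VShattered staircase (level j)
  VShattered-level j = VShattered-byOffsets staircase (level j) (toℕ j)
    (staircase-realises (j ,_) proj₂ (λ _ → refl))

  allColumns : Subset Column (k * d)
  allColumns = subsetWithRetraction (remQuot {k} d) (uncurry combine) (Fin.combine-remQuot {k} d)

  PShattered-allColumns : PShattered staircase allColumns
  PShattered-allColumns = PShattered-byOffsets staircase allColumns _
    (staircase-realises (remQuot {k} d) (uncurry combine) (Fin.combine-remQuot {k} d))

open Staircase

corollary4 : (d k : ℕ) → d ≥ 1 → k ≥ 1 →
    Σ Set λ X → Σ Set λ Y → Σ (Matrix X Y k) λ A →
      Vdim≡ A d × Vdim≡ (dot A) d × Pdim≡ A (k * d)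
corollary4 d k@(suc _) _ _ =
  Row k d , Column k d , A ,
  ((firstLevel , firstLevel-shattered) ,
     λ _ → VShattered-size≤ A proj₂ (blocks-comparable k d)) ,
  ((firstLevel , VShattered-dot A firstLevel firstLevel-shattered) ,
     λ _ → VShattered-size≤ (dot A) proj₂
             (Sum.map (Dominated-dot A) (Dominated-dot A) ∘ blocks-comparable k d)) ,
  ((allColumns k d , PShattered-allColumns k d) ,
     λ _ J _ → Subset-size≤ (uncurry combine) uncurry-combine-injective J)
  where
  A : Matrix (Row k d) (Column k d) k
  A = staircase k d
  firstLevel : Subset (Column k d) d
  firstLevel = level k d zero
  firstLevel-shattered : VShattered A firstLevel
  firstLevel-shattered = VShattered-level k d zero
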